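{- Let $G$ be a finite simple graph. If $\mathrm{corona}(G)$ is a critical set, then $|\mathrm{corona}(G)|+|N(\mathrm{core}(G))|=|V(G)|$ and $\mathrm{core}(G)$ is critical.
   Context: For $X\subseteq V(G)$, $N(X)$ is the set of vertices adjacent to some vertex of $X$, $d(X)=|X|-|N(X)|$, $d(G)=\max\{d(X):X\subseteq V(G)\}$, and $X$ is critical if $d(X)=d(G)$. $\Omega(G)$ is the family of maximum independent sets, $\mathrm{core}(G)=\bigcap\Omega(G)$, $\mathrm{corona}(G)=\bigcup\Omega(G)$. -}

module Defs where

open import Data.Nat using (ℕ; _≤_)
open import Data.Integer using (ℤ; _-_; +_) renaming (_≤_ to _≤ℤ_)
open import Data.Bool using (Bool; true; false; _∧_)
open import Data.Fin using (Fin)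
open import Data.Fin.Subset using (Subset; _∈_; ∣_∣)
open import Data.Vec using (tabulate; lookup)
open import Data.List using (allFin)
open import Data.Bool.ListAction using (any)
open import Data.Product using (_×_; ∃)
open import Relation.Binary.PropositionalEquality using (_≡_)
open import Function.Bundles using (_⇔_)

record Graph (n : ℕ) : Set where
  field
    adj       : Fin n → Fin n → Bool
    adj-sym   : ∀ u v → adj u v ≡ adj v u
    adj-irrefl : ∀ v → adj v v ≡ false
open Graph public

N : ∀ {n} → Graph n → Subset n → Subset n
N {n} G X = tabulate λ v → any (λ u → lookup X u ∧ adj G u v) (allFin n)

d : ∀ {n} → Graph n → Subset n → ℤ
d G X = + ∣ X ∣ - + ∣ N G X ∣

Critical : ∀ {n} → Graph n → Subset n → Set
Critical G X = ∀ Y → d G Y ≤ℤ d G X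

Independent : ∀ {n} → Graph n → Subset n → Set
Independent G S = ∀ u v → u ∈ S → v ∈ S → adj G u v ≡ false

MaxIndependent : ∀ {n} → Graph n → Subset n → Set
MaxIndependent G S = Independent G S × (∀ T → Independent G T → ∣ T ∣ ≤ ∣ S ∣)

IsCore : ∀ {n} → Graph n → Subset n → Set
IsCore G K = ∀ v → (v ∈ K) ⇔ (∀ S → MaxIndependent G S → v ∈ S)

IsCorona : ∀ {n} → Graph n → Subset n → Set
IsCorona G C = ∀ v → (v ∈ C) ⇔ ∃ (λ S → MaxIndependent G S × v ∈ S)

-- Every maximum independent set contains core(G), so it misses N(core(G)); hence
-- corona(G) and N(core(G)) are disjoint and |corona| + |N(core)| ≤ |V|.  Dually, a
-- vertex outside N(corona(G)) can be added to any maximum independent set without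
-- creating an edge, so by maximality it already lies in every one of them; hence
-- V ∖ N(corona) ⊆ core and |V| ≤ |core| + |N(corona)|.  Criticality of corona gives
-- d(core) ≤ d(corona), i.e. |core| + |N(corona)| ≤ |corona| + |N(core)|, which closes
-- the chain |V| ≤ … ≤ |V|: all its inequalities are equalities, and d(core) = d(corona).
module Submission where

open import Defs
open import Data.Nat using (ℕ; _+_)
open import Data.Fin.Subset using (Subset; ∣_∣)
open import Data.Product using (_×_)
open import Relation.Binary.PropositionalEquality using (_≡_)

open import Data.Nat as ℕ using (_≤_; _∸_)
import Data.Nat.Properties as ℕ
open import Data.Integer as ℤ using (+_; _-_)
import Data.Integer.Properties as ℤ
open import Data.Integer.Tactic.RingSolver using (solve-∀)
open import Data.Fin using (Fin)
open import Data.Fin.Subset using (_∈_; _∉_; _∪_; ⁅_⁆; ∁; _⊆_)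
open import Data.Fin.Subset.Properties
open import Data.Vec using (lookup; tabulate)
open import Data.Vec.Properties using (lookup∘tabulate; []=⇒lookup; lookup⇒[]=)
open import Data.List using (allFin)
open import Data.List.Relation.Unary.Any using (satisfied)
open import Data.List.Relation.Unary.Any.Properties using (any⁺; any⁻)
open import Data.List.Membership.Propositional using (lose)
open import Data.List.Membership.Propositional.Properties using (∈-allFin)
open import Data.Bool using (true; false; _∧_)
open import Data.Bool.Properties using (T-≡; T-∧)
open import Data.Bool.ListAction using (any)
open import Data.Product using (_,_; proj₁; proj₂; ∃)
open import Data.Sum using (inj₁; inj₂)
open import Relation.Nullary using (yes; no; contradiction)
open import Relation.Binary.PropositionalEquality using (refl; sym; trans; cong; subst₂)
open import Function.Bundles using (_⇔_; mk⇔; Equivalence)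

open Equivalence

m-n≤o-p⇔m+p≤o+n : ∀ m n o p → (+ m - + n ℤ.≤ + o - + p) ⇔ (m + p ≤ o + n)
m-n≤o-p⇔m+p≤o+n m n o p = mk⇔ forward backward
  where
  shiftˡ : ∀ i j k → (i - j) ℤ.+ (j ℤ.+ k) ≡ i ℤ.+ k
  shiftˡ = solve-∀
  shiftʳ : ∀ i j k → (i - k) ℤ.+ (j ℤ.+ k) ≡ i ℤ.+ j
  shiftʳ = solve-∀
  unshiftˡ : ∀ i j k → (i ℤ.+ k) - (j ℤ.+ k) ≡ i - j
  unshiftˡ = solve-∀
  unshiftʳ : ∀ i j k → (i ℤ.+ j) - (j ℤ.+ k) ≡ i - k
  unshiftʳ = solve-∀

  forward : + m - + n ℤ.≤ + o - + p → m + p ≤ o + n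
  forward le = ℤ.drop‿+≤+ (subst₂ ℤ._≤_
    (trans (shiftˡ (+ m) (+ n) (+ p)) (sym (ℤ.pos-+ m p)))
    (trans (shiftʳ (+ o) (+ n) (+ p)) (sym (ℤ.pos-+ o n)))
    (ℤ.+-monoˡ-≤ (+ n ℤ.+ + p) le))

  backward : m + p ≤ o + n → + m - + n ℤ.≤ + o - + p
  backward le = subst₂ ℤ._≤_ (unshiftˡ (+ m) (+ n) (+ p)) (unshiftʳ (+ o) (+ n) (+ p))
    (ℤ.+-monoˡ-≤ (ℤ.- (+ n ℤ.+ + p)) (subst₂ ℤ._≤_ (ℤ.pos-+ m p) (ℤ.pos-+ o n) (ℤ.+≤+ le)))

p⊆∁q⇒∣p∣+∣q∣≤n : ∀ {n} {p q : Subset n} → p ⊆ ∁ q → ∣ p ∣ + ∣ q ∣ ≤ n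
p⊆∁q⇒∣p∣+∣q∣≤n {n} {p} {q} p⊆∁q = begin
  ∣ p ∣ + ∣ q ∣         ≤⟨ ℕ.+-monoˡ-≤ ∣ q ∣ (p⊆q⇒∣p∣≤∣q∣ p⊆∁q) ⟩
  ∣ ∁ q ∣ + ∣ q ∣       ≡⟨ cong (_+ ∣ q ∣) (∣∁p∣≡n∸∣p∣ q) ⟩
  n ∸ ∣ q ∣ + ∣ q ∣     ≡⟨ ℕ.m∸n+n≡m (∣p∣≤n q) ⟩
  n                     ∎
  where open ℕ.≤-Reasoning

∁p⊆q⇒n≤∣p∣+∣q∣ : ∀ {n} {p q : Subset n} → ∁ p ⊆ q → n ≤ ∣ p ∣ + ∣ q ∣
∁p⊆q⇒n≤∣p∣+∣q∣ {n} {p} {q} ∁p⊆q = begin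
  n                     ≡⟨ ℕ.m∸n+n≡m (∣p∣≤n p) ⟨
  n ∸ ∣ p ∣ + ∣ p ∣     ≡⟨ cong (_+ ∣ p ∣) (∣∁p∣≡n∸∣p∣ p) ⟨
  ∣ ∁ p ∣ + ∣ p ∣       ≤⟨ ℕ.+-monoˡ-≤ ∣ p ∣ (p⊆q⇒∣p∣≤∣q∣ ∁p⊆q) ⟩
  ∣ q ∣ + ∣ p ∣         ≡⟨ ℕ.+-comm ∣ q ∣ ∣ p ∣ ⟩
  ∣ p ∣ + ∣ q ∣         ∎
  where open ℕ.≤-Reasoning

module _ {n} (G : Graph n) where

  lookup-N : ∀ X v → lookup (N G X) v ≡ any (λ u → lookup X u ∧ adj G u v) (allFin n)
  lookup-N X v = lookup∘tabulate _ v

  ∈N⇒adjacent : ∀ {X v} → v ∈ N G X → ∃ λ u → u ∈ X × adj G u v ≡ true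
  ∈N⇒adjacent {X} {v} v∈NX
    with u , t ← satisfied (any⁻ _ (allFin n) (from T-≡ (trans (sym (lookup-N X v)) ([]=⇒lookup v∈NX))))
    = u , lookup⇒[]= u X (to T-≡ (proj₁ (to T-∧ t))) , to T-≡ (proj₂ (to T-∧ t))

  adjacent⇒∈N : ∀ {X u v} → u ∈ X → adj G u v ≡ true → v ∈ N G X
  adjacent⇒∈N {X} {u} {v} u∈X uv = lookup⇒[]= v (N G X) (trans (lookup-N X v)
    (to T-≡ (any⁺ _ (lose (∈-allFin u) (from T-∧ (from T-≡ ([]=⇒lookup u∈X) , from T-≡ uv))))))

  Nonadjacent : Subset n → Fin n → Set
  Nonadjacent S x = ∀ u → u ∈ S → adj G u x ≡ false

  ∉N⇒nonadjacent : ∀ {X x} → x ∉ N G X → Nonadjacent X x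
  ∉N⇒nonadjacent {x = x} x∉NX u u∈X with adj G u x in ux
  ... | false = refl
  ... | true  = contradiction (adjacent⇒∈N u∈X ux) x∉NX

  independent-∪⁅⁆ : ∀ {S x} → Independent G S → Nonadjacent S x → Independent G (S ∪ ⁅ x ⁆)
  independent-∪⁅⁆ {S} {x} indS S≁x u v u∈ v∈ with x∈p∪q⁻ S ⁅ x ⁆ u∈ | x∈p∪q⁻ S ⁅ x ⁆ v∈
  ... | inj₁ u∈S | inj₁ v∈S = indS u v u∈S v∈S
  ... | inj₁ u∈S | inj₂ v∈x rewrite x∈⁅y⁆⇒x≡y x v∈x = S≁x u u∈S
  ... | inj₂ u∈x | inj₁ v∈S rewrite x∈⁅y⁆⇒x≡y x u∈x = trans (adj-sym G x v) (S≁x v v∈S)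
  ... | inj₂ u∈x | inj₂ v∈x rewrite x∈⁅y⁆⇒x≡y x u∈x | x∈⁅y⁆⇒x≡y x v∈x = adj-irrefl G x

  maxIndependent-absorbs : ∀ {S x} → MaxIndependent G S → Nonadjacent S x → x ∈ S
  maxIndependent-absorbs {S} {x} (indS , maximum) S≁x with x ∈? S
  ... | yes x∈S = x∈S
  ... | no  x∉S = contradiction (maximum (S ∪ ⁅ x ⁆) (independent-∪⁅⁆ indS S≁x))
                    (ℕ.<⇒≱ (p⊂q⇒∣p∣<∣q∣ (p⊆p∪q ⁅ x ⁆ , x , x∈p∪q⁺ (inj₂ (x∈⁅x⁆ x)) , x∉S)))

  independent-avoids-N : ∀ {S X v} → Independent G S → X ⊆ S → v ∈ S → v ∉ N G X
  independent-avoids-N {v = v} indS X⊆S v∈S v∈NX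
    with u , u∈X , uv ← ∈N⇒adjacent v∈NX
    with () ← trans (sym uv) (indS u v (X⊆S u∈X) v∈S)

  module _ {K C : Subset n} (core : IsCore G K) (corona : IsCorona G C) where

    corona⊆∁N[core] : C ⊆ ∁ (N G K)
    corona⊆∁N[core] {v} v∈C with S , maxS , v∈S ← to (corona v) v∈C =
      x∉p⇒x∈∁p (independent-avoids-N (proj₁ maxS) (λ {k} k∈K → to (core k) k∈K S maxS) v∈S)

    ∁core⊆N[corona] : ∁ K ⊆ N G C
    ∁core⊆N[corona] {x} x∈∁K with x ∈? N G C
    ... | yes x∈NC = x∈NC
    ... | no  x∉NC = contradiction (from (core x) λ S maxS → maxIndependent-absorbs maxS
                         λ u u∈S → ∉N⇒nonadjacent x∉NC u (from (corona u) (S , maxS , u∈S)))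
                       (x∈∁p⇒x∉p x∈∁K)

corollary3p4 : ∀ {n} (G : Graph n) (K C : Subset n) → IsCore G K → IsCorona G C →
    Critical G C → (∣ C ∣ + ∣ N G K ∣ ≡ n) × Critical G K
corollary3p4 {n} G K C core corona criticalC =
  ℕ.≤-antisym upper (ℕ.≤-trans lower dK≤dC) ,
  λ Y → ℤ.≤-trans (criticalC Y) (from (m-n≤o-p⇔m+p≤o+n (∣ C ∣) (∣ N G C ∣) (∣ K ∣) (∣ N G K ∣))
                                       (ℕ.≤-trans upper lower))
  where
  upper : ∣ C ∣ + ∣ N G K ∣ ≤ n
  upper = p⊆∁q⇒∣p∣+∣q∣≤n (corona⊆∁N[core] G core corona)
  lower : n ≤ ∣ K ∣ + ∣ N G C ∣
  lower = ∁p⊆q⇒n≤∣p∣+∣q∣ (∁core⊆N[corona] G core corona)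
  dK≤dC : ∣ K ∣ + ∣ N G C ∣ ≤ ∣ C ∣ + ∣ N G K ∣
  dK≤dC = to (m-n≤o-p⇔m+p≤o+n (∣ K ∣) (∣ N G K ∣) (∣ C ∣) (∣ N G C ∣)) (criticalC K)
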